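{- Let $A$ be either the Klein four-group $V_4\cong\mathbb{Z}_2\times\mathbb{Z}_2$ or the cyclic group $\mathbb{Z}_p$ for a prime $p$, and let $G$ be an $A$-vertex magic graph. Then $spec(G,A)$ is a subgroup of $A$ if and only if $0\in spec(G,A)$.
   Context: All graphs are finite, simple and connected. For an additive abelian group $A$ with identity $0$ and a graph $G$, an $A$-vertex magic labeling of $G$ is a map $l:V(G)\to A\setminus\{0\}$ for which there is $\mu\in A$ (the magic constant) such that $w(v):=\sum_{u\in N_G(v)} l(u)=\mu$ for every $v\in V(G)$, where $N_G(v)$ is the set of neighbours of $v$. $G$ is $A$-vertex magic if it admits such a labeling. The group magic spectrum is $spec(G,A)=\{\mu : \mu$ is the magic constant of some $A$-vertex magic labeling of $G\}\subseteq A$. -}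

module Defs where

open import Data.Nat using (ℕ; zero; suc; _<_; NonZero)
import Data.Nat as ℕ
open import Data.Nat.DivMod using (_mod_)
open import Data.Nat.Primality using (Prime; prime⇒nonZero)
open import Data.Fin using (Fin; toℕ)
open import Data.Bool using (Bool; true; false; if_then_else_; _xor_)
open import Data.Product using (Σ; ∃; _×_; _,_)
open import Relation.Binary.PropositionalEquality using (_≡_)
open import Relation.Nullary using (¬_)

data Walk {n : ℕ} (adj : Fin n → Fin n → Bool) : Fin n → Fin n → Set where
  here : ∀ {u} → Walk adj u u
  step : ∀ {u v w} → adj u v ≡ true → Walk adj v w → Walk adj u w

record Graph : Set where
  field
    n         : ℕ
    adj       : Fin n → Fin n → Bool
    sym       : ∀ u v → adj u v ≡ adj v u
    irrefl    : ∀ v → adj v v ≡ false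
    nonEmpty  : 0 < n
    connected : ∀ u v → Walk adj u v

record AbGroupOps : Set₁ where
  field
    Carrier : Set
    0#      : Carrier
    _+_     : Carrier → Carrier → Carrier
    -_      : Carrier → Carrier

V₄ : AbGroupOps
V₄ = record
  { Carrier = Bool × Bool
  ; 0#      = false , false
  ; _+_     = λ { (a , b) (c , d) → (a xor c) , (b xor d) }
  ; -_      = λ x → x
  }

Zmod : (p : ℕ) → Prime p → AbGroupOps
Zmod p pr = record
  { Carrier = Fin p
  ; 0#      = 0 mod p
  ; _+_     = λ a b → (toℕ a ℕ.+ toℕ b) mod p
  ; -_      = λ a → (p ℕ.∸ toℕ a) mod p
  }
  where instance _ = prime⇒nonZero pr

module _ (A : AbGroupOps) where
  open AbGroupOps A

  sumFin : ∀ {m} → (Fin m → Carrier) → Carrier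
  sumFin {zero}  f = 0#
  sumFin {suc m} f = f Fin.zero + sumFin (λ i → f (Fin.suc i))

  module _ (G : Graph) where
    open Graph G

    weight : (Fin n → Carrier) → Fin n → Carrier
    weight l v = sumFin (λ u → if adj v u then l u else 0#)

    IsMagicLabeling : (Fin n → Carrier) → Carrier → Set
    IsMagicLabeling l μ = (∀ v → ¬ (l v ≡ 0#)) × (∀ v → weight l v ≡ μ)

    IsVertexMagic : Set
    IsVertexMagic = Σ (Fin n → Carrier) λ l → ∃ λ μ → IsMagicLabeling l μ

    Spec : Carrier → Set
    Spec μ = Σ (Fin n → Carrier) λ l → IsMagicLabeling l μ

  IsSubgroup : (Carrier → Set) → Set
  IsSubgroup S = S 0# × (∀ x y → S x → S y → S (x + y)) × (∀ x → S x → S (- x))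

module Submission where

-- A map φ : A → A that is additive and sends nonzero elements to nonzero elements turns a
-- magic labeling l with constant μ into the magic labeling φ ∘ l with constant φ μ. For V₄
-- the cyclic automorphism of order 3, and for ℤ_p the multiplications by units, act
-- transitively on A ∖ {0}; so spec(G, A) either meets A ∖ {0} not at all or contains all of it,
-- and once 0 ∈ spec(G, A) it is {0} or A, a subgroup either way.

open import Defs
open import Data.Nat using (ℕ)
open import Data.Nat.Primality using (Prime)
open import Data.Product using (_×_)
open import Function.Bundles using (_⇔_)

open import Algebra.Bundles using (CommutativeRing)
open import Data.Bool using (true; false; if_then_else_; _xor_)
import Data.Bool.Properties as Bool
open import Data.Empty using (⊥-elim)
open import Data.Fin using (Fin; zero; suc; toℕ)
import Data.Fin as Fin
open import Data.Fin.Properties using (toℕ-injective; toℕ-fromℕ<; toℕ<n)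
open import Data.Nat as ℕ using (NonZero; _∸_; _%_; _<_; ≢-nonZero; ≢-nonZero⁻¹)
open import Data.Nat.Coprimality using (prime⇒coprime; coprime-Bézout)
open import Data.Nat.DivMod
  using (_mod_; %-distribˡ-+; %-distribˡ-*; %-pred-≡0; m%n%n≡m%n; m*n%n≡0; n%n≡0; [m+kn]%n≡m%n; m<n⇒m%n≡m)
open import Data.Nat.Divisibility using (_∣_; _∤_; ∣-trans; m∣m*n; m%n≡0⇒n∣m; n∣m⇒m%n≡0)
open import Data.Nat.GCD using (module Bézout)
open import Data.Nat.Primality using (prime⇒nonZero; prime⇒nonTrivial; euclidsLemma)
open import Data.Nat.Properties using (*-distribˡ-+; *-identityʳ; *-zeroʳ; m<n⇒0<n∸m)
open import Data.Nat.Tactic.RingSolver using (solve-∀)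
open import Data.Product using (∃; _,_; proj₁)
open import Data.Product.Properties using (≡-dec)
open import Data.Sum using (_⊎_; inj₁; inj₂)
open import Function using (_∘_)
open import Function.Bundles using (mk⇔)
open import Relation.Binary.Definitions using (DecidableEquality)
open import Relation.Binary.PropositionalEquality
open import Relation.Nullary using (yes; no; contradiction)

module _ (A : AbGroupOps) where
  open AbGroupOps A

  sumFin-cong : ∀ {m} {f g : Fin m → Carrier} → (∀ i → f i ≡ g i) → sumFin A f ≡ sumFin A g
  sumFin-cong {ℕ.zero}  f≗g = refl
  sumFin-cong {ℕ.suc m} f≗g = cong₂ _+_ (f≗g zero) (sumFin-cong (f≗g ∘ suc))

  module _ {φ : Carrier → Carrier}
           (φ-+ : ∀ x y → φ (x + y) ≡ φ x + φ y) (φ-0# : φ 0# ≡ 0#) where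

    sumFin-homo : ∀ {m} (f : Fin m → Carrier) → sumFin A (φ ∘ f) ≡ φ (sumFin A f)
    sumFin-homo {ℕ.zero}  f = sym φ-0#
    sumFin-homo {ℕ.suc m} f = begin
      φ (f zero) + sumFin A (φ ∘ f ∘ suc) ≡⟨ cong (φ (f zero) +_) (sumFin-homo (f ∘ suc)) ⟩
      φ (f zero) + φ (sumFin A (f ∘ suc)) ≡⟨ φ-+ _ _ ⟨
      φ (sumFin A f)                      ∎
      where open ≡-Reasoning

    if-then-0#-homo : ∀ b x → (if b then φ x else 0#) ≡ φ (if b then x else 0#)
    if-then-0#-homo true  x = refl
    if-then-0#-homo false x = sym φ-0#

    weight-homo : ∀ G l v → weight A G (φ ∘ l) v ≡ φ (weight A G l v)
    weight-homo G l v =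
      trans (sumFin-cong (λ u → if-then-0#-homo (Graph.adj G v u) (l u)))
            (sumFin-homo (λ u → if Graph.adj G v u then l u else 0#))

    Spec-map : (∀ x → φ x ≡ 0# → x ≡ 0#) → ∀ G {μ} → Spec A G μ → Spec A G (φ μ)
    Spec-map φ-reflects-0# G (l , l≢0# , wl≡μ) =
      φ ∘ l , (λ v → l≢0# v ∘ φ-reflects-0# (l v)) , λ v → trans (weight-homo G l v) (cong φ (wl≡μ v))

  Homogeneous : (Carrier → Set) → Set
  Homogeneous S = ∀ {x z} → x ≢ 0# → z ≢ 0# → S x → S z

  module _ (_≟_ : DecidableEquality Carrier) (0#+0#≡0# : 0# + 0# ≡ 0#) (-0#≡0# : - 0# ≡ 0#)
           {S : Carrier → Set} (S-homogeneous : Homogeneous S) where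

    isSubgroup⇔0#∈ : IsSubgroup A S ⇔ S 0#
    isSubgroup⇔0#∈ = mk⇔ proj₁ isSubgroup
      where
      isSubgroup : S 0# → IsSubgroup A S
      isSubgroup S0# = S0# , +-closed , neg-closed
        where
        ∈-from : ∀ {x z} → S x → (x ≡ 0# → z ≡ 0#) → S z
        ∈-from {x} {z} Sx x≡0#⇒z≡0# with z ≟ 0# | x ≟ 0#
        ... | yes refl | _        = S0#
        ... | no z≢0#  | yes x≡0# = contradiction (x≡0#⇒z≡0# x≡0#) z≢0#
        ... | no z≢0#  | no x≢0#  = S-homogeneous x≢0# z≢0# Sx

        +-closed : ∀ x y → S x → S y → S (x + y)
        +-closed x y Sx Sy with x ≟ 0#
        ... | yes refl = ∈-from Sy λ { refl → 0#+0#≡0# }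
        ... | no x≢0#  = ∈-from Sx (⊥-elim ∘ x≢0#)

        neg-closed : ∀ x → S x → S (- x)
        neg-closed x Sx = ∈-from Sx λ { refl → -0#≡0# }

module KleinFour where
  open AbGroupOps V₄
  open import Algebra.Properties.CommutativeSemigroup
    (CommutativeRing.+-commutativeSemigroup Bool.xor-∧-commutativeRing) using (interchange)

  _≟_ : DecidableEquality Carrier
  _≟_ = ≡-dec Bool._≟_ Bool._≟_

  σ : Carrier → Carrier
  σ (a , b) = b , a xor b

  σ-+ : ∀ x y → σ (x + y) ≡ σ x + σ y
  σ-+ (a , b) (c , d) = cong (b xor d ,_) (interchange a c b d)

  σ-reflects-0# : ∀ x → σ x ≡ 0# → x ≡ 0#
  σ-reflects-0# (false , false) _ = refl

  σ-orbit : ∀ {x z} → x ≢ 0# → z ≢ 0# → z ≡ x ⊎ z ≡ σ x ⊎ z ≡ σ (σ x)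
  σ-orbit {false , false} x≢0# _    = contradiction refl x≢0#
  σ-orbit {_} {false , false} _ z≢0# = contradiction refl z≢0#
  σ-orbit {true  , false} {true  , false} _ _ = inj₁ refl
  σ-orbit {true  , false} {false , true } _ _ = inj₂ (inj₁ refl)
  σ-orbit {true  , false} {true  , true } _ _ = inj₂ (inj₂ refl)
  σ-orbit {false , true } {false , true } _ _ = inj₁ refl
  σ-orbit {false , true } {true  , true } _ _ = inj₂ (inj₁ refl)
  σ-orbit {false , true } {true  , false} _ _ = inj₂ (inj₂ refl)
  σ-orbit {true  , true } {true  , true } _ _ = inj₁ refl
  σ-orbit {true  , true } {true  , false} _ _ = inj₂ (inj₁ refl)
  σ-orbit {true  , true } {false , true } _ _ = inj₂ (inj₂ refl)

  Spec-σ : ∀ G {μ} → Spec V₄ G μ → Spec V₄ G (σ μ)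
  Spec-σ = Spec-map V₄ σ-+ refl σ-reflects-0#

  Spec-homogeneous : ∀ G → Homogeneous V₄ (Spec V₄ G)
  Spec-homogeneous G x≢0# z≢0# Sx with σ-orbit x≢0# z≢0#
  ... | inj₁ refl        = Sx
  ... | inj₂ (inj₁ refl) = Spec-σ G Sx
  ... | inj₂ (inj₂ refl) = Spec-σ G (Spec-σ G Sx)

m*[n%d]%d≡m*n%d : ∀ m n d .{{_ : NonZero d}} → (m ℕ.* (n % d)) % d ≡ (m ℕ.* n) % d
m*[n%d]%d≡m*n%d m n d = begin
  (m ℕ.* (n % d)) % d               ≡⟨ %-distribˡ-* m (n % d) d ⟩
  ((m % d) ℕ.* (n % d % d)) % d     ≡⟨ cong (λ t → ((m % d) ℕ.* t) % d) (m%n%n≡m%n n d) ⟩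
  ((m % d) ℕ.* (n % d)) % d         ≡⟨ %-distribˡ-* m n d ⟨
  (m ℕ.* n) % d                     ∎
  where open ≡-Reasoning

[n∸1]*[n∸1]%n≡1 : ∀ n .{{_ : NonZero n}} → 1 < n → ((n ∸ 1) ℕ.* (n ∸ 1)) % n ≡ 1
[n∸1]*[n∸1]%n≡1 (ℕ.suc q) 1<n = begin
  (q ℕ.* q) % ℕ.suc q                          ≡⟨ [m+kn]%n≡m%n (q ℕ.* q) 1 (ℕ.suc q) ⟨
  (q ℕ.* q ℕ.+ 1 ℕ.* ℕ.suc q) % ℕ.suc q        ≡⟨ cong (_% ℕ.suc q) (expand q) ⟩
  (1 ℕ.+ q ℕ.* ℕ.suc q) % ℕ.suc q              ≡⟨ [m+kn]%n≡m%n 1 q (ℕ.suc q) ⟩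
  1 % ℕ.suc q                                  ≡⟨ m<n⇒m%n≡m 1<n ⟩
  1                                            ∎
  where
  open ≡-Reasoning
  expand : ∀ q → q ℕ.* q ℕ.+ 1 ℕ.* ℕ.suc q ≡ 1 ℕ.+ q ℕ.* ℕ.suc q
  expand = solve-∀

module CyclicOfPrimeOrder (p : ℕ) (pr : Prime p) where
  private instance
    p≢0 : NonZero p
    p≢0 = prime⇒nonZero pr

  1<p : 1 < p
  1<p = ℕ.nonTrivial⇒n>1 p {{prime⇒nonTrivial pr}}

  private instance
    p∸1≢0 : NonZero (p ∸ 1)
    p∸1≢0 = ℕ.>-nonZero (m<n⇒0<n∸m 1<p)

  open AbGroupOps (Zmod p pr)

  toℕ-mod : ∀ m → toℕ (m mod p) ≡ m % p
  toℕ-mod m = toℕ-fromℕ< _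

  toℕ-0# : toℕ 0# ≡ 0
  toℕ-0# = trans (toℕ-mod 0) (m*n%n≡0 0 p)

  toℕ≡⇒≢0# : ∀ {a n} → toℕ a ≡ n → .{{NonZero n}} → a ≢ 0#
  toℕ≡⇒≢0# {n = n} toℕa≡n refl = ≢-nonZero⁻¹ n (trans (sym toℕa≡n) toℕ-0#)

  toℕ-nonZero : ∀ {a} → a ≢ 0# → NonZero (toℕ a)
  toℕ-nonZero a≢0# = ≢-nonZero λ toℕa≡0 → a≢0# (toℕ-injective (trans toℕa≡0 (sym toℕ-0#)))

  0#+0#≡0# : 0# + 0# ≡ 0#
  0#+0#≡0# = toℕ-injective (begin
    toℕ (0# + 0#)                ≡⟨ toℕ-mod _ ⟩
    (toℕ 0# ℕ.+ toℕ 0#) % p      ≡⟨ cong₂ (λ a b → (a ℕ.+ b) % p) toℕ-0# toℕ-0# ⟩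
    0 % p                        ≡⟨ toℕ-mod 0 ⟨
    toℕ 0#                       ∎)
    where open ≡-Reasoning

  -0#≡0# : - 0# ≡ 0#
  -0#≡0# = toℕ-injective (begin
    toℕ (- 0#)                   ≡⟨ toℕ-mod _ ⟩
    (p ∸ toℕ 0#) % p             ≡⟨ cong (λ a → (p ∸ a) % p) toℕ-0# ⟩
    p % p                        ≡⟨ n%n≡0 p ⟩
    0                            ≡⟨ toℕ-0# ⟨
    toℕ 0#                       ∎)
    where open ≡-Reasoning

  scale : ℕ → Fin p → Fin p
  scale k a = (k ℕ.* toℕ a) mod p

  toℕ-scale : ∀ k a → toℕ (scale k a) ≡ (k ℕ.* toℕ a) % p
  toℕ-scale k a = toℕ-mod _

  scale-+ : ∀ k a b → scale k (a + b) ≡ scale k a + scale k b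
  scale-+ k a b = toℕ-injective (begin
    toℕ (scale k (a + b))                              ≡⟨ toℕ-scale k (a + b) ⟩
    (k ℕ.* toℕ (a + b)) % p                            ≡⟨ cong (λ t → (k ℕ.* t) % p) (toℕ-mod _) ⟩
    (k ℕ.* ((toℕ a ℕ.+ toℕ b) % p)) % p                ≡⟨ m*[n%d]%d≡m*n%d k _ p ⟩
    (k ℕ.* (toℕ a ℕ.+ toℕ b)) % p                      ≡⟨ cong (_% p) (*-distribˡ-+ k (toℕ a) (toℕ b)) ⟩
    (k ℕ.* toℕ a ℕ.+ k ℕ.* toℕ b) % p                  ≡⟨ %-distribˡ-+ (k ℕ.* toℕ a) (k ℕ.* toℕ b) p ⟩
    ((k ℕ.* toℕ a) % p ℕ.+ (k ℕ.* toℕ b) % p) % p      ≡⟨ cong₂ (λ s t → (s ℕ.+ t) % p) (toℕ-scale k a) (toℕ-scale k b) ⟨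
    (toℕ (scale k a) ℕ.+ toℕ (scale k b)) % p          ≡⟨ toℕ-mod _ ⟨
    toℕ (scale k a + scale k b)                        ∎)
    where open ≡-Reasoning

  scale-0# : ∀ k → scale k 0# ≡ 0#
  scale-0# k = toℕ-injective (begin
    toℕ (scale k 0#)          ≡⟨ toℕ-scale k 0# ⟩
    (k ℕ.* toℕ 0#) % p        ≡⟨ cong (λ t → (k ℕ.* t) % p) toℕ-0# ⟩
    (k ℕ.* 0) % p             ≡⟨ cong (_% p) (*-zeroʳ k) ⟩
    0 % p                     ≡⟨ toℕ-mod 0 ⟨
    toℕ 0#                    ∎)
    where open ≡-Reasoning

  p∣k⇒scale≡0# : ∀ k a → p ∣ k → scale k a ≡ 0#
  p∣k⇒scale≡0# k a p∣k = toℕ-injective (begin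
    toℕ (scale k a)           ≡⟨ toℕ-scale k a ⟩
    (k ℕ.* toℕ a) % p         ≡⟨ n∣m⇒m%n≡0 _ p (∣-trans p∣k (m∣m*n (toℕ a))) ⟩
    0                         ≡⟨ toℕ-0# ⟨
    toℕ 0#                    ∎)
    where open ≡-Reasoning

  scale-reflects-0# : ∀ k → p ∤ k → ∀ a → scale k a ≡ 0# → a ≡ 0#
  scale-reflects-0# k p∤k a ka≡0#
    with euclidsLemma k (toℕ a) pr
           (m%n≡0⇒n∣m _ p (trans (sym (toℕ-scale k a)) (trans (cong toℕ ka≡0#) toℕ-0#)))
  ... | inj₁ p∣k = contradiction p∣k p∤k
  ... | inj₂ p∣a = toℕ-injective (begin
    toℕ a                     ≡⟨ m<n⇒m%n≡m (toℕ<n a) ⟨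
    toℕ a % p                 ≡⟨ n∣m⇒m%n≡0 _ p p∣a ⟩
    0                         ≡⟨ toℕ-0# ⟨
    toℕ 0#                    ∎)
    where open ≡-Reasoning

  Spec-scale : ∀ G k {μ} → Spec (Zmod p pr) G μ → scale k μ ≢ 0# → Spec (Zmod p pr) G (scale k μ)
  Spec-scale G k {μ} Sμ kμ≢0# =
    Spec-map (Zmod p pr) (scale-+ k) (scale-0# k) (scale-reflects-0# k (kμ≢0# ∘ p∣k⇒scale≡0# k μ)) G Sμ

  -- Bézout for the coprime pair (p, a) gives k a ≡ 1 or k a ≡ -1 (mod p), depending on the sign pattern.
  scale-to-±1 : ∀ {a} → a ≢ 0# → ∃ λ k → toℕ (scale k a) ≡ 1 ⊎ toℕ (scale k a) ≡ p ∸ 1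
  scale-to-±1 {a} a≢0#
    with coprime-Bézout (prime⇒coprime pr {{toℕ-nonZero a≢0#}} (toℕ<n a))
  ... | Bézout.-+ x k 1+xp≡ka = k , inj₁ (begin
    toℕ (scale k a)           ≡⟨ toℕ-scale k a ⟩
    (k ℕ.* toℕ a) % p         ≡⟨ cong (_% p) 1+xp≡ka ⟨
    (1 ℕ.+ x ℕ.* p) % p       ≡⟨ [m+kn]%n≡m%n 1 x p ⟩
    1 % p                     ≡⟨ m<n⇒m%n≡m 1<p ⟩
    1                         ∎)
    where open ≡-Reasoning
  ... | Bézout.+- x k 1+ka≡xp = k , inj₂ (trans (toℕ-scale k a)
    (%-pred-≡0 (trans (cong (_% p) 1+ka≡xp) (m*n%n≡0 x p))))

  -1*-1≡1 : ∀ {u} → toℕ u ≡ p ∸ 1 → toℕ (scale (p ∸ 1) u) ≡ 1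
  -1*-1≡1 {u} u≡p∸1 = begin
    toℕ (scale (p ∸ 1) u)           ≡⟨ toℕ-scale (p ∸ 1) u ⟩
    ((p ∸ 1) ℕ.* toℕ u) % p         ≡⟨ cong (λ t → ((p ∸ 1) ℕ.* t) % p) u≡p∸1 ⟩
    ((p ∸ 1) ℕ.* (p ∸ 1)) % p       ≡⟨ [n∸1]*[n∸1]%n≡1 p 1<p ⟩
    1                               ∎
    where open ≡-Reasoning

  scale-identityʳ : ∀ {u} z → toℕ u ≡ 1 → scale (toℕ z) u ≡ z
  scale-identityʳ {u} z u≡1 = toℕ-injective (begin
    toℕ (scale (toℕ z) u)     ≡⟨ toℕ-scale (toℕ z) u ⟩
    (toℕ z ℕ.* toℕ u) % p     ≡⟨ cong (λ t → (toℕ z ℕ.* t) % p) u≡1 ⟩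
    (toℕ z ℕ.* 1) % p         ≡⟨ cong (_% p) (*-identityʳ (toℕ z)) ⟩
    toℕ z % p                 ≡⟨ m<n⇒m%n≡m (toℕ<n z) ⟩
    toℕ z                     ∎)
    where open ≡-Reasoning

  Spec-from-1 : ∀ G {u z} → toℕ u ≡ 1 → z ≢ 0# → Spec (Zmod p pr) G u → Spec (Zmod p pr) G z
  Spec-from-1 G {u} {z} u≡1 z≢0# Su =
    subst (Spec (Zmod p pr) G) z-scaled (Spec-scale G (toℕ z) Su (subst (_≢ 0#) (sym z-scaled) z≢0#))
    where
    z-scaled : scale (toℕ z) u ≡ z
    z-scaled = scale-identityʳ z u≡1

  Spec-homogeneous : ∀ G → Homogeneous (Zmod p pr) (Spec (Zmod p pr) G)
  Spec-homogeneous G x≢0# z≢0# Sx with scale-to-±1 x≢0#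
  ... | k , inj₁ kx≡1   = Spec-from-1 G kx≡1 z≢0# (Spec-scale G k Sx (toℕ≡⇒≢0# kx≡1))
  ... | k , inj₂ kx≡p∸1 = Spec-from-1 G (-1*-1≡1 kx≡p∸1) z≢0#
    (Spec-scale G (p ∸ 1) (Spec-scale G k Sx (toℕ≡⇒≢0# kx≡p∸1)) (toℕ≡⇒≢0# (-1*-1≡1 kx≡p∸1)))

mainTheorem1 : ((G : Graph) → IsVertexMagic V₄ G
    → (IsSubgroup V₄ (Spec V₄ G) ⇔ Spec V₄ G (AbGroupOps.0# V₄)))
    × ((p : ℕ) (pr : Prime p) (G : Graph) → IsVertexMagic (Zmod p pr) G
    → (IsSubgroup (Zmod p pr) (Spec (Zmod p pr) G) ⇔ Spec (Zmod p pr) G (AbGroupOps.0# (Zmod p pr))))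
mainTheorem1 =
  (λ G _ → isSubgroup⇔0#∈ V₄ KleinFour._≟_ refl refl (KleinFour.Spec-homogeneous G)) ,
  (λ p pr G _ → let open CyclicOfPrimeOrder p pr in
    isSubgroup⇔0#∈ (Zmod p pr) Fin._≟_ 0#+0#≡0# -0#≡0# (Spec-homogeneous G))
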